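{- Let $k\in\mathbb{N}$ and let $\mathcal{H}$ be a class of 2-rooted graphs, none of which has more than $k$ edges between its two roots. Let $\mathcal{H}^-$ be the class of graphs obtained from graphs of $\mathcal{H}$ by removing all edges between the two roots. If $(\mathcal{H},\unlhd)$ is a well-quasi-order, then so is $(\mathcal{H}^-,\unlhd)$.
   Context: Graphs are finite, may have parallel edges, no loops; $\mathrm{mult}_G(x,y)$ is the number of edges between $x$ and $y$. A model of $H$ in $G$ is a map $\mu:V(H)\to\mathcal{P}(V(G))$ such that: the sets $\mu(x)$ are pairwise disjoint and partition $V(G)$; each $G[\mu(x)]$ is connected; and for distinct $x,y\in V(H)$, $\mathrm{mult}_H(x,y)=\sum_{(x',y')\in\mu(x)\times\mu(y)}\mathrm{mult}_G(x',y')$. A 2-rooted graph is a graph $G$ with two distinct distinguished vertices $G.r,G.s$ (the roots). For 2-rooted graphs, $H\unlhd G$ means there is a model $\mu$ of $H$ in $G$ with $G.r\in\mu(H.r)$ and $G.s\in\mu(H.s)$. A poset is a well-quasi-order if every infinite sequence $x_0,x_1,\dots$ has indices $i<j$ with $x_i\unlhd x_j$. -}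

module Defs where

open import Data.Nat using (ℕ; zero; suc; _+_; _*_; _≤_; _<_)
open import Data.Fin using (Fin; zero; suc; _≟_)
open import Data.Bool using (Bool; true; false; _∧_; _∨_; if_then_else_; T)
open import Data.Bool.Properties using (∧-comm; ∨-comm)
open import Data.Product using (Σ; _×_; _,_; ∃)
open import Relation.Nullary using (¬_)
open import Data.Empty using (⊥)
open import Relation.Nullary.Decidable using (⌊_⌋)
open import Relation.Binary.PropositionalEquality using (_≡_; refl; cong; cong₂; trans)

-- Finite loopless multigraph on vertex set Fin size; mult x y = number of
-- edges between x and y.
record Graph : Set where
  field
    size     : ℕ
    mult     : Fin size → Fin size → ℕ
    mult-sym : ∀ x y → mult x y ≡ mult y x
    loopless : ∀ x → mult x x ≡ 0
open Graph public

record RGraph : Set where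
  field
    graph : Graph
    r     : Fin (size graph)
    s     : Fin (size graph)
    r≢s   : ¬ (r ≡ s)
open RGraph public

sumFin : (n : ℕ) → (Fin n → ℕ) → ℕ
sumFin zero    f = 0
sumFin (suc n) f = f zero + sumFin n (λ i → f (suc i))

Subset : ℕ → Set
Subset n = Fin n → Bool

data Reach (G : Graph) (S : Subset (size G)) : Fin (size G) → Fin (size G) → Set where
  here : ∀ {u} → Reach G S u u
  step : ∀ {u w v} → 0 < mult G u w → T (S w) → Reach G S w v → Reach G S u v

ConnectedIn : (G : Graph) → Subset (size G) → Set
ConnectedIn G S =
  (Σ (Fin (size G)) λ v → T (S v)) ×
  (∀ u v → T (S u) → T (S v) → Reach G S u v)

indic : Bool → ℕ → ℕ
indic b m = if b then m else 0

edgesBetween : (G : Graph) → Subset (size G) → Subset (size G) → ℕ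
edgesBetween G S T' =
  sumFin (size G) λ a → sumFin (size G) λ b → indic (S a ∧ T' b) (mult G a b)

record Model (H G : Graph) : Set where
  field
    μ         : Fin (size H) → Subset (size G)
    disjoint  : ∀ x y → ¬ (x ≡ y) → ∀ v → T (μ x v) → T (μ y v) → ⊥
    cover     : ∀ v → Σ (Fin (size H)) λ x → T (μ x v)
    connected : ∀ x → ConnectedIn G (μ x)
    edges     : ∀ x y → ¬ (x ≡ y) → mult H x y ≡ edgesBetween G (μ x) (μ y)
open Model public

_⊴_ : RGraph → RGraph → Set
H ⊴ G = Σ (Model (graph H) (graph G)) λ m →
          T (μ m (r H) (r G)) × T (μ m (s H) (s G))

Class : Set₁
Class = RGraph → Set

WQO : Class → Set
WQO C = (f : ℕ → RGraph) → (∀ i → C (f i)) →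
        Σ ℕ λ i → Σ ℕ λ j → (i < j) × (f i ⊴ f j)

module _ (G : RGraph) where
  private
    n = size (graph G)
    isRootPair : Fin n → Fin n → Bool
    isRootPair x y = (⌊ x ≟ r G ⌋ ∧ ⌊ y ≟ s G ⌋) ∨ (⌊ x ≟ s G ⌋ ∧ ⌊ y ≟ r G ⌋)

    isRootPair-sym : ∀ x y → isRootPair x y ≡ isRootPair y x
    isRootPair-sym x y =
      trans (∨-comm (⌊ x ≟ r G ⌋ ∧ ⌊ y ≟ s G ⌋) (⌊ x ≟ s G ⌋ ∧ ⌊ y ≟ r G ⌋))
            (cong₂ _∨_ (∧-comm ⌊ x ≟ s G ⌋ ⌊ y ≟ r G ⌋) (∧-comm ⌊ x ≟ r G ⌋ ⌊ y ≟ s G ⌋))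

    mult⁻ : Fin n → Fin n → ℕ
    mult⁻ x y = if isRootPair x y then 0 else mult (graph G) x y

    mult⁻-sym : ∀ x y → mult⁻ x y ≡ mult⁻ y x
    mult⁻-sym x y rewrite isRootPair-sym x y with isRootPair y x
    ... | true  = refl
    ... | false = mult-sym (graph G) x y

    loopless⁻ : ∀ x → mult⁻ x x ≡ 0
    loopless⁻ x with isRootPair x x
    ... | true  = refl
    ... | false = loopless (graph G) x

  removeRootEdges : RGraph
  removeRootEdges = record
    { graph = record { size = n ; mult = mult⁻ ; mult-sym = mult⁻-sym ; loopless = loopless⁻ }
    ; r = r G ; s = s G ; r≢s = r≢s G }

_⁻ : Class → Class
(C ⁻) G' = Σ RGraph λ G → C G × (G' ≡ removeRootEdges G)

module Submission where

-- Write ρ(G) for the number of edges between the roots of a 2-rooted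
-- graph G, and G⁻ for G with those edges removed.  Two facts about a
-- rooted model μ of H in G drive the proof.
--   (1) The ρ(H) edges of G between μ(H.r) and μ(H.s) are the ρ(G) root
--       edges of G together with the edges of G⁻ there; hence ρ(G) ≤ ρ(H).
--   (2) If moreover ρ(H) = ρ(G), the same μ is a rooted model of H⁻ in G⁻:
--       no branch set contains both roots of G, so the branch sets stay
--       connected in G⁻, and the edge counts of H⁻ and G⁻ between branch
--       sets are those of H and G minus the same amount ρ.
-- The combinatorial part is a general fact: if every sequence has a good
-- pair i < j with x_i ≼ x_j, and w is a bounded weight with x ≼ y ⇒ w y ≤ w x,
-- then every sequence has a good pair of equal weight.  It is proved by
-- induction on the bound, passing to a subsequence of strictly smaller
-- weight whenever good pairs of equal weight are not found.
-- The theorem follows: a sequence in H⁻ comes from a sequence in H with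
-- ρ ≤ k, whose equal-weight good pair gives a good pair in H⁻ by (2).

open import Defs
open import Data.Nat using (ℕ; _≤_)
open import Data.Nat using (zero; suc; _+_; _<_; _<′_; ≤′-refl; ≤′-step)
open import Data.Nat.Properties
  using ( +-identityʳ; +-cancelʳ-≡; +-commutativeSemigroup; m≤m+n; m≤n+m
        ; n≤0⇒n≡0; ≤∧≢⇒<; <-≤-trans; ≤-pred; <-trans; <⇒<′; ≤-reflexive; ≤-trans
        ; +-monoʳ-<) renaming (_≟_ to _≟ℕ_)
open import Algebra.Properties.CommutativeSemigroup +-commutativeSemigroup
  using (interchange)
open import Data.Fin using (Fin; _≟_)
open import Data.Fin.Properties using (suc-injective)
open import Data.Bool using (Bool; true; false; _∧_; _∨_; if_then_else_; T)
open import Data.Bool.Properties using (T-∧; T-∨; T-≡)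
open import Data.Product using (Σ; _×_; _,_; proj₁; proj₂)
open import Data.Sum using (_⊎_; inj₁; inj₂)
open import Data.Empty using (⊥; ⊥-elim)
open import Function using (_∘_; Equivalence)
open import Relation.Nullary using (¬_; Dec; yes; no)
open import Relation.Nullary.Decidable using (⌊_⌋)
open import Relation.Binary.PropositionalEquality
  using (_≡_; _≢_; refl; sym; trans; cong; cong₂; subst; subst₂; module ≡-Reasoning)

open Equivalence using (to; from)

sum-cong : ∀ n {f g : Fin n → ℕ} → (∀ i → f i ≡ g i) → sumFin n f ≡ sumFin n g
sum-cong zero    f≗g = refl
sum-cong (suc n) f≗g = cong₂ _+_ (f≗g Fin.zero) (sum-cong n (f≗g ∘ Fin.suc))

sum-+ : ∀ n (f g : Fin n → ℕ) →
        sumFin n (λ i → f i + g i) ≡ sumFin n f + sumFin n g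
sum-+ zero    f g = refl
sum-+ (suc n) f g =
  trans (cong (f Fin.zero + g Fin.zero +_) (sum-+ n (f ∘ Fin.suc) (g ∘ Fin.suc)))
        (interchange (f Fin.zero) (g Fin.zero) _ _)

sum-zero : ∀ n (f : Fin n → ℕ) → (∀ i → f i ≡ 0) → sumFin n f ≡ 0
sum-zero zero    f f≗0 = refl
sum-zero (suc n) f f≗0 = cong₂ _+_ (f≗0 Fin.zero) (sum-zero n (f ∘ Fin.suc) (f≗0 ∘ Fin.suc))

sum-single : ∀ n (f : Fin n → ℕ) p → (∀ i → i ≢ p → f i ≡ 0) → sumFin n f ≡ f p
sum-single (suc n) f Fin.zero f≗0 =
  trans (cong (f Fin.zero +_) (sum-zero n (f ∘ Fin.suc) (λ i → f≗0 (Fin.suc i) λ ())))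
        (+-identityʳ _)
sum-single (suc n) f (Fin.suc p) f≗0 =
  cong₂ _+_ (f≗0 Fin.zero λ ())
            (sum-single n (f ∘ Fin.suc) p (λ i i≢p → f≗0 (Fin.suc i) (i≢p ∘ suc-injective)))

sum²-single : ∀ n (f : Fin n → Fin n → ℕ) p q →
              (∀ a b → ¬ (a ≡ p × b ≡ q) → f a b ≡ 0) →
              sumFin n (λ a → sumFin n (f a)) ≡ f p q
sum²-single n f p q f≗0 =
  trans (sum-single n _ p (λ a a≢p → sum-zero n (f a) (λ b → f≗0 a b (a≢p ∘ proj₁))))
        (sum-single n (f p) q (λ b b≢q → f≗0 p b (b≢q ∘ proj₂)))

indic-true : ∀ {b} m → T b → indic b m ≡ m
indic-true {true} m _ = refl

indic-false : ∀ {b} m → ¬ T b → indic b m ≡ 0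
indic-false {true}  m ¬b = ⊥-elim (¬b _)
indic-false {false} m ¬b = refl

T-∧³ : ∀ {x y z} → T (x ∧ (y ∧ z)) → T x × T y × T z
T-∧³ xyz = let x , yz = to T-∧ xyz in x , to T-∧ yz

indic-split : ∀ x y q m →
              indic (x ∧ y) m ≡ indic (x ∧ y) (if q then 0 else m) + indic (x ∧ (y ∧ q)) m
indic-split true  true  true  m = refl
indic-split true  true  false m = sym (+-identityʳ m)
indic-split true  false q     m = refl
indic-split false y     q     m = refl

-- {x , y} is the pair of roots.  This is literally the test inside
-- removeRootEdges, so mult (graph⁻ G) x y unfolds to
-- if isRootPair G x y then 0 else mult (graph G) x y.
isRootPair : (G : RGraph) → Fin (size (graph G)) → Fin (size (graph G)) → Bool
isRootPair G x y = (⌊ x ≟ r G ⌋ ∧ ⌊ y ≟ s G ⌋) ∨ (⌊ x ≟ s G ⌋ ∧ ⌊ y ≟ r G ⌋)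

dec-∧-elim : ∀ {A B : Set} (a : Dec A) (b : Dec B) → T (⌊ a ⌋ ∧ ⌊ b ⌋) → A × B
dec-∧-elim (yes a) (yes b) _ = a , b

dec-∧-intro : ∀ {A B : Set} (a : Dec A) (b : Dec B) → A → B → T (⌊ a ⌋ ∧ ⌊ b ⌋)
dec-∧-intro (yes _) (yes _) _ _ = _
dec-∧-intro (yes _) (no ¬b) _ b = ¬b b
dec-∧-intro (no ¬a) _       a _ = ¬a a

isRootPair-sound : ∀ G x y → T (isRootPair G x y) →
                   (x ≡ r G × y ≡ s G) ⊎ (x ≡ s G × y ≡ r G)
isRootPair-sound G x y t with to (T-∨ {⌊ x ≟ r G ⌋ ∧ ⌊ y ≟ s G ⌋} {⌊ x ≟ s G ⌋ ∧ ⌊ y ≟ r G ⌋}) t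
... | inj₁ rs = inj₁ (dec-∧-elim (x ≟ r G) (y ≟ s G) rs)
... | inj₂ sr = inj₂ (dec-∧-elim (x ≟ s G) (y ≟ r G) sr)

isRootPair-complete : ∀ G x y → (x ≡ r G × y ≡ s G) ⊎ (x ≡ s G × y ≡ r G) →
                      T (isRootPair G x y)
isRootPair-complete G x y rs⊎sr =
  from (T-∨ {⌊ x ≟ r G ⌋ ∧ ⌊ y ≟ s G ⌋} {⌊ x ≟ s G ⌋ ∧ ⌊ y ≟ r G ⌋}) (intro rs⊎sr)
  where
  intro : (x ≡ r G × y ≡ s G) ⊎ (x ≡ s G × y ≡ r G) →
          T (⌊ x ≟ r G ⌋ ∧ ⌊ y ≟ s G ⌋) ⊎ T (⌊ x ≟ s G ⌋ ∧ ⌊ y ≟ r G ⌋)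
  intro (inj₁ (x≡r , y≡s)) = inj₁ (dec-∧-intro (x ≟ r G) (y ≟ s G) x≡r y≡s)
  intro (inj₂ (x≡s , y≡r)) = inj₂ (dec-∧-intro (x ≟ s G) (y ≟ r G) x≡s y≡r)

rootMult : RGraph → ℕ
rootMult G = mult (graph G) (r G) (s G)

graph⁻ : RGraph → Graph
graph⁻ G = graph (removeRootEdges G)

mult-split : ∀ G x y →
             mult (graph G) x y ≡ mult (graph⁻ G) x y + indic (isRootPair G x y) (rootMult G)
mult-split G x y with isRootPair G x y in eq
... | false = sym (+-identityʳ _)
... | true with isRootPair-sound G x y (from T-≡ eq)
...   | inj₁ (refl , refl) = refl
...   | inj₂ (refl , refl) = mult-sym (graph G) (s G) (r G)

rootEdgesBetween : (G : RGraph) → Subset (size (graph G)) → Subset (size (graph G)) → ℕ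
rootEdgesBetween G X Y =
  sumFin n λ a → sumFin n λ b → indic (X a ∧ (Y b ∧ isRootPair G a b)) (mult (graph G) a b)
  where n = size (graph G)

edgesBetween-split : ∀ G X Y →
  edgesBetween (graph G) X Y ≡ edgesBetween (graph⁻ G) X Y + rootEdgesBetween G X Y
edgesBetween-split G X Y =
  trans (sum-cong n λ a →
           trans (sum-cong n λ b → indic-split (X a) (Y b) (isRootPair G a b) (mult (graph G) a b))
                 (sum-+ n _ _))
        (sum-+ n _ _)
  where n = size (graph G)

rootEdgesBetween-none : ∀ G X Y → (∀ a b → T (X a) → T (Y b) → ¬ T (isRootPair G a b)) →
                        rootEdgesBetween G X Y ≡ 0
rootEdgesBetween-none G X Y none =
  sum-zero n _ λ a → sum-zero n _ λ b → indic-false _ λ t →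
    let Xa , Yb , ab = T-∧³ t in none a b Xa Yb ab
  where n = size (graph G)

rootEdgesBetween-single : ∀ G X Y p q →
  (∀ a b → T (X a) → T (Y b) → T (isRootPair G a b) → a ≡ p × b ≡ q) →
  T (X p) → T (Y q) → T (isRootPair G p q) → rootEdgesBetween G X Y ≡ mult (graph G) p q
rootEdgesBetween-single G X Y p q only Xp Yq pq =
  trans (sum²-single n _ p q λ a b ab≢pq → indic-false _ λ t →
           let Xa , Yb , ab = T-∧³ t in ab≢pq (only a b Xa Yb ab))
        (indic-true _ (from T-∧ (Xp , from T-∧ (Yq , pq))))
  where n = size (graph G)

-- A walk of G inside a vertex set X containing at most one root uses no
-- root edge, so it is a walk of G⁻; hence G[X] connected ⇒ G⁻[X] connected.
module _ (G : RGraph) (X : Subset (size (graph G)))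
         (oneRoot : T (X (r G)) → T (X (s G)) → ⊥) where

  edge-graph⁻ : ∀ {u w} → T (X u) → T (X w) → 0 < mult (graph G) u w → 0 < mult (graph⁻ G) u w
  edge-graph⁻ {u} {w} Xu Xw uw with isRootPair G u w in eq
  ... | false = uw
  ... | true with isRootPair-sound G u w (from T-≡ eq)
  ...   | inj₁ (refl , refl) = ⊥-elim (oneRoot Xu Xw)
  ...   | inj₂ (refl , refl) = ⊥-elim (oneRoot Xw Xu)

  reach-graph⁻ : ∀ {u v} → T (X u) → Reach (graph G) X u v → Reach (graph⁻ G) X u v
  reach-graph⁻ Xu here              = here
  reach-graph⁻ Xu (step uw Xw walk) = step (edge-graph⁻ Xu Xw uw) Xw (reach-graph⁻ Xw walk)

  connected-graph⁻ : ConnectedIn (graph G) X → ConnectedIn (graph⁻ G) X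
  connected-graph⁻ (v , walks) = v , λ u w Xu Xw → reach-graph⁻ Xu (walks u w Xu Xw)

module RootedModel (H G : RGraph) (m : Model (graph H) (graph G))
                   (rootʳ : T (μ m (r H) (r G))) (rootˢ : T (μ m (s H) (s G))) where

  branch-r : ∀ x → T (μ m x (r G)) → x ≡ r H
  branch-r x x∋r with x ≟ r H
  ... | yes x≡r = x≡r
  ... | no  x≢r = ⊥-elim (disjoint m x (r H) x≢r (r G) x∋r rootʳ)

  branch-s : ∀ x → T (μ m x (s G)) → x ≡ s H
  branch-s x x∋s with x ≟ s H
  ... | yes x≡s = x≡s
  ... | no  x≢s = ⊥-elim (disjoint m x (s H) x≢s (s G) x∋s rootˢ)

  oneRoot : ∀ x → T (μ m x (r G)) → T (μ m x (s G)) → ⊥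
  oneRoot x x∋r x∋s = r≢s H (trans (sym (branch-r x x∋r)) (branch-s x x∋s))

  branch-rootPair : ∀ x y a b → T (μ m x a) → T (μ m y b) → T (isRootPair G a b) →
                    T (isRootPair H x y)
  branch-rootPair x y a b x∋a y∋b ab with isRootPair-sound G a b ab
  ... | inj₁ (refl , refl) = isRootPair-complete H x y (inj₁ (branch-r x x∋a , branch-s y y∋b))
  ... | inj₂ (refl , refl) = isRootPair-complete H x y (inj₂ (branch-s x x∋a , branch-r y y∋b))

  rootPair-from-r : ∀ a b → T (μ m (r H) a) → T (isRootPair G a b) → a ≡ r G × b ≡ s G
  rootPair-from-r a b r∋a ab with isRootPair-sound G a b ab
  ... | inj₁ rs          = rs
  ... | inj₂ (refl , _) = ⊥-elim (r≢s H (branch-s (r H) r∋a))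

  rootPair-from-s : ∀ a b → T (μ m (s H) a) → T (isRootPair G a b) → a ≡ s G × b ≡ r G
  rootPair-from-s a b s∋a ab with isRootPair-sound G a b ab
  ... | inj₁ (refl , _) = ⊥-elim (r≢s H (sym (branch-r (s H) s∋a)))
  ... | inj₂ sr          = sr

  rootEdges-branch : ∀ x y →
    rootEdgesBetween G (μ m x) (μ m y) ≡ indic (isRootPair H x y) (rootMult G)
  rootEdges-branch x y with isRootPair H x y in eq
  ... | false = rootEdgesBetween-none G _ _ λ a b x∋a y∋b ab →
                  subst T eq (branch-rootPair x y a b x∋a y∋b ab)
  ... | true with isRootPair-sound H x y (from T-≡ eq)
  ...   | inj₁ (refl , refl) =
    rootEdgesBetween-single G _ _ (r G) (s G) (λ a b r∋a _ → rootPair-from-r a b r∋a)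
      rootʳ rootˢ (isRootPair-complete G _ _ (inj₁ (refl , refl)))
  ...   | inj₂ (refl , refl) =
    trans (rootEdgesBetween-single G _ _ (s G) (r G) (λ a b s∋a _ → rootPair-from-s a b s∋a)
             rootˢ rootʳ (isRootPair-complete G _ _ (inj₂ (refl , refl))))
          (mult-sym (graph G) (s G) (r G))

  mult-branch : ∀ x y → x ≢ y →
    mult (graph H) x y ≡ edgesBetween (graph⁻ G) (μ m x) (μ m y) + indic (isRootPair H x y) (rootMult G)
  mult-branch x y x≢y = begin
    mult (graph H) x y                                          ≡⟨ edges m x y x≢y ⟩
    edgesBetween (graph G) (μ m x) (μ m y)                       ≡⟨ edgesBetween-split G (μ m x) (μ m y) ⟩
    edgesBetween (graph⁻ G) (μ m x) (μ m y) + rootEdgesBetween G (μ m x) (μ m y)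
                                                                ≡⟨ cong (_ +_) (rootEdges-branch x y) ⟩
    edgesBetween (graph⁻ G) (μ m x) (μ m y) + indic (isRootPair H x y) (rootMult G) ∎
    where open ≡-Reasoning

  rootMult-branch : rootMult H ≡ edgesBetween (graph⁻ G) (μ m (r H)) (μ m (s H)) + rootMult G
  rootMult-branch =
    trans (mult-branch (r H) (s H) (r≢s H))
          (cong (edgesBetween (graph⁻ G) (μ m (r H)) (μ m (s H)) +_)
                (indic-true _ (isRootPair-complete H _ _ (inj₁ (refl , refl)))))

⊴-rootMult : ∀ {H G} → H ⊴ G → rootMult G ≤ rootMult H
⊴-rootMult {H} {G} (m , rootʳ , rootˢ) = ≤-trans (m≤n+m _ _) (≤-reflexive (sym rootMult-branch))
  where open RootedModel H G m rootʳ rootˢ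

⊴-removeRootEdges : ∀ {H G} → H ⊴ G → rootMult H ≡ rootMult G →
                    removeRootEdges H ⊴ removeRootEdges G
⊴-removeRootEdges {H} {G} (m , rootʳ , rootˢ) sameRootMult = model⁻ , rootʳ , rootˢ
  where
  open RootedModel H G m rootʳ rootˢ

  edges⁻ : ∀ x y → x ≢ y → mult (graph⁻ H) x y ≡ edgesBetween (graph⁻ G) (μ m x) (μ m y)
  edges⁻ x y x≢y = +-cancelʳ-≡ (indic xy (rootMult H)) _ _ (begin
    mult (graph⁻ H) x y + indic xy (rootMult H)  ≡⟨ mult-split H x y ⟨
    mult (graph H) x y                           ≡⟨ mult-branch x y x≢y ⟩
    e⁻ + indic xy (rootMult G)                   ≡⟨ cong (λ ρ → e⁻ + indic xy ρ) sameRootMult ⟨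
    e⁻ + indic xy (rootMult H)                   ∎)
    where
    open ≡-Reasoning
    xy = isRootPair H x y
    e⁻ = edgesBetween (graph⁻ G) (μ m x) (μ m y)

  model⁻ : Model (graph⁻ H) (graph⁻ G)
  model⁻ = record
    { μ         = μ m
    ; disjoint  = disjoint m
    ; cover     = cover m
    ; connected = λ x → connected-graph⁻ G (μ m x) (oneRoot x) (connected m x)
    ; edges     = edges⁻
    }

module _ {X : Set} {Q : ℕ → Set} (search : ∀ p → X ⊎ Σ ℕ λ q → p ≤ q × Q q) where

  private
    advance : Σ ℕ Q → Σ ℕ Q
    advance (q , Qq) with search (suc q)
    ... | inj₁ _               = q , Qq
    ... | inj₂ (q′ , _ , Qq′) = q′ , Qq′

    advance-< : ∀ i → X ⊎ proj₁ i < proj₁ (advance i)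
    advance-< (q , Qq) with search (suc q)
    ... | inj₁ x              = inj₁ x
    ... | inj₂ (_ , q<q′ , _) = inj₂ q<q′

    iterate : Σ ℕ Q → ℕ → Σ ℕ Q
    iterate i zero    = i
    iterate i (suc n) = advance (iterate i n)

    iterate-< : ∀ i {a b} → a <′ b → X ⊎ proj₁ (iterate i a) < proj₁ (iterate i b)
    iterate-< i {a} ≤′-refl           = advance-< (iterate i a)
    iterate-< i {a} (≤′-step {b} a<b) with iterate-< i a<b | advance-< (iterate i b)
    ... | inj₁ x   | _        = inj₁ x
    ... | inj₂ _   | inj₁ x   = inj₁ x
    ... | inj₂ a<b | inj₂ b<c = inj₂ (<-trans a<b b<c)

  extract : X ⊎ Σ (ℕ → Σ ℕ Q) λ σ → ∀ {a b} → a < b → X ⊎ proj₁ (σ a) < proj₁ (σ b)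
  extract with search 0
  ... | inj₁ x             = inj₁ x
  ... | inj₂ (q , _ , Qq) = inj₂ (iterate (q , Qq) , iterate-< (q , Qq) ∘ <⇒<′)

-- By induction on c: a good
-- pair of unequal weight lands at weight ≤ c, so either an equal-weight
-- pair turns up or there is a subsequence of weight ≤ c.
module _ {A : Set} (_≼_ : A → A → Set) (P : A → Set)
         (good : (f : ℕ → A) → (∀ i → P (f i)) → Σ ℕ λ i → Σ ℕ λ j → i < j × f i ≼ f j)
         (w : A → ℕ) (w-antitone : ∀ {x y} → x ≼ y → w y ≤ w x) where

  EqualWeightPair : (ℕ → A) → Set
  EqualWeightPair f = Σ ℕ λ i → Σ ℕ λ j → i < j × f i ≼ f j × w (f i) ≡ w (f j)

  equalWeightPair : ∀ c (f : ℕ → A) → (∀ n → P (f n)) → (∀ n → w (f n) ≤ c) → EqualWeightPair f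
  equalWeightPair zero f Pf bounded =
    let i , j , i<j , fi≼fj = good f Pf
    in  i , j , i<j , fi≼fj , trans (n≤0⇒n≡0 (bounded i)) (sym (n≤0⇒n≡0 (bounded j)))
  equalWeightPair (suc c) f Pf bounded with extract search
    where
    search : ∀ p → EqualWeightPair f ⊎ Σ ℕ λ q → p ≤ q × w (f q) ≤ c
    search p with good (λ n → f (p + n)) (λ n → Pf (p + n))
    ... | i , j , i<j , fi≼fj with w (f (p + i)) ≟ℕ w (f (p + j))
    ...   | yes same = inj₁ (p + i , p + j , +-monoʳ-< p i<j , fi≼fj , same)
    ...   | no  diff = inj₂ (p + j , m≤m+n p j ,
                  ≤-pred (<-≤-trans (≤∧≢⇒< (w-antitone fi≼fj) (diff ∘ sym)) (bounded (p + i))))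
  ... | inj₁ pair = pair
  ... | inj₂ (σ , σ-increasing)
    with equalWeightPair c (f ∘ proj₁ ∘ σ) (Pf ∘ proj₁ ∘ σ) (proj₂ ∘ σ)
  ...   | a , b , a<b , ≼ab , sameab with σ-increasing a<b
  ...     | inj₁ pair = pair
  ...     | inj₂ σa<σb = proj₁ (σ a) , proj₁ (σ b) , σa<σb , ≼ab , sameab

lemma4 : (k : ℕ) (H : Class) →
    (∀ G → H G → mult (graph G) (r G) (s G) ≤ k) →
    WQO H → WQO (H ⁻)
lemma4 k H bounded wqo f f∈H⁻ =
  let i , j , i<j , Fi⊴Fj , sameRootMult =
        equalWeightPair _⊴_ H wqo rootMult (λ {G} {G′} → ⊴-rootMult {G} {G′})
                        k F F∈H (λ n → bounded (F n) (F∈H n))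
  in  i , j , i<j ,
      subst₂ _⊴_ (sym (f≡F⁻ i)) (sym (f≡F⁻ j))
                 (⊴-removeRootEdges {F i} {F j} Fi⊴Fj sameRootMult)
  where
  F : ℕ → RGraph
  F n = proj₁ (f∈H⁻ n)

  F∈H : ∀ n → H (F n)
  F∈H n = proj₁ (proj₂ (f∈H⁻ n))

  f≡F⁻ : ∀ n → f n ≡ removeRootEdges (F n)
  f≡F⁻ n = proj₂ (proj₂ (f∈H⁻ n))
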